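{- Let $f:\mathbb{N}\to\mathbb{N}$ be a computable function. If $f$ is linear (of the form $f(n)=Cn+D$) or if the function $n\mapsto \frac{f(n)}{n}$ computably converges to $\infty$, then $f$ is manageable.
   Context: $\mathbb{N}=\{0,1,2,\dots\}$. A function $h$ computably converges to $\infty$ if there is a computable map $K\mapsto n_K$ ($K\in\mathbb{N}$) with $h(n)\ge K$ for all $n\ge n_K$. A function $f:\mathbb{N}\to\mathbb{R}_{\ge0}$ is manageable if there is an algorithm which, given any $k$, positive integers $A_0,\dots,A_k$ and non-negative integers $B_0,\dots,B_k$, decides whether $f(A_0+x_1A_1+\dots+x_kA_k)<B_0+x_1B_1+\dots+x_kB_k$ holds for some $x_1,\dots,x_k\in\mathbb{N}$. -}

module Defs where

open import Data.Nat using (ℕ; _+_; _*_; _<_; _≤_)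
open import Data.Vec using (Vec; []; _∷_)
open import Data.Vec.Relation.Unary.All using (All)
open import Data.Product using (Σ; ∃)
open import Relation.Nullary using (Dec)
open import Relation.Binary.PropositionalEquality using (_≡_)

dot : ∀ {k} → Vec ℕ k → Vec ℕ k → ℕ
dot []       []       = 0
dot (x ∷ xs) (a ∷ as) = x * a + dot xs as

-- f is manageable: there is an algorithm (an Agda function, hence computable)
-- which for any k, positive A₀,…,Aₖ and non-negative B₀,…,Bₖ decides whether
-- ∃ x₁,…,xₖ ∈ ℕ. f(A₀ + Σ xᵢAᵢ) < B₀ + Σ xᵢBᵢ.
Manageable : (ℕ → ℕ) → Set
Manageable f =
  (k : ℕ) (A₀ : ℕ) (A : Vec ℕ k) (B₀ : ℕ) (B : Vec ℕ k) →
  0 < A₀ → All (0 <_) A →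
  Dec (∃ λ (x : Vec ℕ k) → f (A₀ + dot x A) < B₀ + dot x B)

Linear : (ℕ → ℕ) → Set
Linear f = Σ ℕ λ C → Σ ℕ λ D → ∀ n → f n ≡ C * n + D

-- n ↦ f(n)/n computably converges to ∞: a (computable) map K ↦ n_K with
-- f(n)/n ≥ K, i.e. K * n ≤ f n, for all n ≥ n_K.
RatioComputablyToInfinity : (ℕ → ℕ) → Set
RatioComputablyToInfinity f =
  Σ (ℕ → ℕ) λ nK → ∀ K n → nK K ≤ n → K * n ≤ f n

-- In the linear case f(A₀ + x·A) = C·A₀ + D + C·(x·A) is affine in x, so the
-- question is whether some coordinate has Bᵢ > C·Aᵢ: if so, moving along that
-- coordinate makes the right-hand side overtake the left; if not, the
-- right-hand side grows no faster than the left and x = 0 is the best choice.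
-- In the superlinear case B₀ + x·B < K·(A₀ + x·A) for K = 1 + B₀ + ΣB, so a
-- solution x has A₀ + x·A < n_K, which bounds every coordinate of x and
-- reduces the question to a finite search.
module Submission where

open import Defs
open import Data.Nat using (ℕ; zero; suc; _+_; _*_; _<_; _≤_; _<?_; z≤n; >-nonZero)
open import Data.Nat.Properties
open import Data.Nat.Tactic.RingSolver using (solve)
open import Data.List using () renaming ([] to []ᴸ; _∷_ to _∷ᴸ_)
open import Algebra.Properties.CommutativeSemigroup *-commutativeSemigroup using (x∙yz≈y∙xz)
open import Data.Product using (∃; _,_; _×_)
open import Data.Sum using (_⊎_; inj₁; inj₂)
open import Data.Vec using (Vec; []; _∷_; replicate; sum)
open import Data.Vec.Relation.Unary.All using (All; []; _∷_)
import Data.Vec.Relation.Unary.All as All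
open import Data.Vec.Relation.Binary.Pointwise.Inductive using (Pointwise; []; _∷_)
open import Relation.Nullary using (Dec; yes; no)
open import Relation.Nullary.Decidable using (map′)
open import Relation.Binary.PropositionalEquality using (_≡_; refl; trans; cong; module ≡-Reasoning)

private variable k : ℕ

dot-replicate-0 : (A : Vec ℕ k) → dot (replicate k 0) A ≡ 0
dot-replicate-0 []      = refl
dot-replicate-0 (_ ∷ A) = dot-replicate-0 A

dot-unit : ∀ t a (A : Vec ℕ k) → dot (t ∷ replicate k 0) (a ∷ A) ≡ t * a
dot-unit t a A = trans (cong (t * a +_) (dot-replicate-0 A)) (+-identityʳ (t * a))

dot-≤-* : ∀ M {A B : Vec ℕ k} → Pointwise (λ a b → b ≤ M * a) A B →
          ∀ x → dot x B ≤ M * dot x A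
dot-≤-* M []                            []       = z≤n
dot-≤-* M {a ∷ A} {b ∷ B} (b≤Ma ∷ B≤MA) (x ∷ xs) = begin
  x * b + dot xs B           ≤⟨ +-mono-≤ (*-monoʳ-≤ x b≤Ma) (dot-≤-* M B≤MA xs) ⟩
  x * (M * a) + M * dot xs A ≡⟨ cong (_+ M * dot xs A) (x∙yz≈y∙xz x M a) ⟩
  M * (x * a) + M * dot xs A ≡⟨ *-distribˡ-+ M (x * a) (dot xs A) ⟨
  M * (x * a + dot xs A)     ∎
  where open ≤-Reasoning

coordinate-≤-dot : {A : Vec ℕ k} → All (0 <_) A → ∀ x → All (_≤ dot x A) x
coordinate-≤-dot []                []       = []
coordinate-≤-dot {A = a ∷ A} (a>0 ∷ A>0) (x ∷ xs) =
  ≤-trans (m≤m*n x a {{>-nonZero a>0}}) (m≤m+n (x * a) (dot xs A))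
  ∷ All.map (λ xᵢ≤ → ≤-trans xᵢ≤ (m≤n+m (dot xs A) (x * a))) (coordinate-≤-dot A>0 xs)

≤-sum : (B : Vec ℕ k) → All (_≤ sum B) B
≤-sum []      = []
≤-sum (b ∷ B) = m≤m+n b (sum B) ∷ All.map (λ bᵢ≤ → ≤-trans bᵢ≤ (m≤n+m (sum B) b)) (≤-sum B)

pointwise-≤-* : ∀ {M} {A B : Vec ℕ k} → All (0 <_) A → All (_≤ M) B →
                Pointwise (λ a b → b ≤ M * a) A B
pointwise-≤-*         []          []          = []
pointwise-≤-* {M = M} (a>0 ∷ A>0) (b≤M ∷ B≤M) =
  ≤-trans b≤M (m≤m*n M _ {{>-nonZero a>0}}) ∷ pointwise-≤-* A>0 B≤M

bounded-search : ∀ k b {P : Vec ℕ k → Set} → (∀ x → Dec (P x)) →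
                 Dec (∃ λ x → All (_< b) x × P x)
bounded-search zero    b P? =
  map′ (λ p → [] , [] , p) (λ { ([] , [] , p) → p }) (P? [])
bounded-search (suc k) b P? =
  map′ (λ (n , n<b , xs , xs<b , p) → n ∷ xs , n<b ∷ xs<b , p)
       (λ { (n ∷ xs , n<b ∷ xs<b , p) → n , n<b , xs , xs<b , p })
       (anyUpTo? (λ n → bounded-search k b (λ xs → P? (n ∷ xs))) b)

search-if-bounded : ∀ b {P : Vec ℕ k → Set} → (∀ x → Dec (P x)) →
                    (∀ x → P x → All (_< b) x) → Dec (∃ P)
search-if-bounded {k} b P? bounded =
  map′ (λ (x , _ , p) → x , p) (λ (x , p) → x , bounded x p , p) (bounded-search k b P?)

solvable-at-origin : (f : ℕ → ℕ) (A₀ : ℕ) (A : Vec ℕ k) (B₀ : ℕ) (B : Vec ℕ k) → f A₀ < B₀ →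
                     ∃ λ x → f (A₀ + dot x A) < B₀ + dot x B
solvable-at-origin {k} f A₀ A B₀ B fA₀<B₀ = replicate k 0 , at-origin
  where
  at-origin : f (A₀ + dot (replicate k 0) A) < B₀ + dot (replicate k 0) B
  at-origin rewrite dot-replicate-0 A | dot-replicate-0 B | +-identityʳ A₀ | +-identityʳ B₀ =
    fA₀<B₀

linear-dichotomy : ∀ C (A B : Vec ℕ k) →
                   (∀ t → ∃ λ x → t + C * dot x A ≤ dot x B) ⊎ Pointwise (λ a b → b ≤ C * a) A B
linear-dichotomy C []      []      = inj₂ []
linear-dichotomy C (a ∷ A) (b ∷ B) with C * a <? b | linear-dichotomy C A B
... | yes Ca<b | _          = inj₁ λ t → t ∷ replicate _ 0 , unit-overtakes t
  where
  unit-overtakes : ∀ t → t + C * dot (t ∷ replicate _ 0) (a ∷ A) ≤ dot (t ∷ replicate _ 0) (b ∷ B)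
  unit-overtakes t rewrite dot-unit t a A | dot-unit t b B = begin
    t + C * (t * a)  ≡⟨ solve (t ∷ᴸ C ∷ᴸ a ∷ᴸ []ᴸ) ⟩
    t * suc (C * a)  ≤⟨ *-monoʳ-≤ t Ca<b ⟩
    t * b            ∎
    where open ≤-Reasoning
... | no  Ca≮b | inj₁ grows = inj₁ λ t → let x , overtakes = grows t in 0 ∷ x , overtakes
... | no  Ca≮b | inj₂ B≤CA = inj₂ (≮⇒≥ Ca≮b ∷ B≤CA)

linear-+ : ∀ {f : ℕ → ℕ} C {D} → (∀ n → f n ≡ C * n + D) → ∀ m n → f (m + n) ≡ f m + C * n
linear-+ {f} C {D} f≡ m n = begin
  f (m + n)          ≡⟨ f≡ (m + n) ⟩
  C * (m + n) + D    ≡⟨ solve (C ∷ᴸ D ∷ᴸ m ∷ᴸ n ∷ᴸ []ᴸ) ⟩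
  C * m + D + C * n  ≡⟨ cong (_+ C * n) (f≡ m) ⟨
  f m + C * n        ∎
  where open ≡-Reasoning

linear-manageable : ∀ f → Linear f → Manageable f
linear-manageable f (C , _ , f≡) k A₀ A B₀ B _ _ with linear-dichotomy C A B
... | inj₁ grows with grows (suc (f A₀))
...   | x , overtakes = yes (x , (begin-strict
        f (A₀ + dot x A)    ≡⟨ linear-+ C f≡ A₀ (dot x A) ⟩
        f A₀ + C * dot x A  <⟨ overtakes ⟩
        dot x B             ≤⟨ m≤n+m (dot x B) B₀ ⟩
        B₀ + dot x B        ∎))
  where open ≤-Reasoning
linear-manageable f (C , _ , f≡) k A₀ A B₀ B _ _ | inj₂ B≤CA with f A₀ <? B₀
... | yes fA₀<B₀ = yes (solvable-at-origin f A₀ A B₀ B fA₀<B₀)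
... | no  fA₀≮B₀ = no λ (x , lt) → <⇒≱ lt (begin
        B₀ + dot x B        ≤⟨ +-mono-≤ (≮⇒≥ fA₀≮B₀) (dot-≤-* C B≤CA x) ⟩
        f A₀ + C * dot x A  ≡⟨ linear-+ C f≡ A₀ (dot x A) ⟨
        f (A₀ + dot x A)    ∎)
  where open ≤-Reasoning

affine-<-slope : ∀ {A₀} {A : Vec ℕ k} B₀ B → 0 < A₀ → All (0 <_) A → ∀ x →
                 B₀ + dot x B < suc (B₀ + sum B) * (A₀ + dot x A)
affine-<-slope {A₀ = A₀} {A} B₀ B A₀>0 A>0 x = begin-strict
  B₀ + dot x B                ≤⟨ +-mono-≤ (m≤m*n B₀ N {{>-nonZero N>0}}) dot-B≤ ⟩
  B₀ * N + sum B * N          ≡⟨ *-distribʳ-+ N B₀ (sum B) ⟨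
  (B₀ + sum B) * N            <⟨ +-monoˡ-≤ ((B₀ + sum B) * N) N>0 ⟩
  suc (B₀ + sum B) * N        ∎
  where
  open ≤-Reasoning
  N = A₀ + dot x A
  N>0 : 0 < N
  N>0 = ≤-trans A₀>0 (m≤m+n A₀ (dot x A))
  dot-B≤ : dot x B ≤ sum B * N
  dot-B≤ = ≤-trans (dot-≤-* (sum B) (pointwise-≤-* A>0 (≤-sum B)) x)
                   (*-monoʳ-≤ (sum B) (m≤n+m (dot x A) A₀))

superlinear-manageable : ∀ f → RatioComputablyToInfinity f → Manageable f
superlinear-manageable f (nK , superlinear) k A₀ A B₀ B A₀>0 A>0 =
  search-if-bounded (nK K) (λ x → f (A₀ + dot x A) <? B₀ + dot x B) solution-bounded
  where
  K = suc (B₀ + sum B)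
  argument-bounded : ∀ x → f (A₀ + dot x A) < B₀ + dot x B → A₀ + dot x A < nK K
  argument-bounded x lt = ≰⇒> λ nK≤N →
    <⇒≱ (<-trans lt (affine-<-slope B₀ B A₀>0 A>0 x)) (superlinear K _ nK≤N)
  solution-bounded : ∀ x → f (A₀ + dot x A) < B₀ + dot x B → All (_< nK K) x
  solution-bounded x lt =
    All.map (λ xᵢ≤ → ≤-<-trans (≤-trans xᵢ≤ (m≤n+m (dot x A) A₀)) (argument-bounded x lt))
            (coordinate-≤-dot A>0 x)

proposition2p3 : (f : ℕ → ℕ) → Linear f ⊎ RatioComputablyToInfinity f → Manageable f
proposition2p3 f (inj₁ linear)      = linear-manageable f linear
proposition2p3 f (inj₂ superlinear) = superlinear-manageable f superlinear
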